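{- Let $I_1,I_2$ be interval-posets of sizes $n>0$ and $m>0$. Then $\mathrm{contacts}(I_1\prec I_2)=\mathrm{contacts}(I_1)+\mathrm{contacts}(I_2)$ and $\mathrm{CV}(I_1\prec I_2)=(\mathrm{contacts}(I_1)+\mathrm{contacts}(I_2),\mathrm{c}_1(I_1),\dots,\mathrm{c}_{n-1}(I_1),0,\mathrm{c}_1(I_2),\dots,\mathrm{c}_{m-1}(I_2))$; and for $0\le i\le\mathrm{contacts}(I_2)$, $\mathrm{contacts}(I_1\succ_i I_2)=\mathrm{contacts}(I_1)+\mathrm{contacts}(I_2)-i$ and $\mathrm{CV}(I_1\succ_i I_2)=(\mathrm{contacts}(I_1)+\mathrm{contacts}(I_2)-i,\mathrm{c}_1(I_1),\dots,\mathrm{c}_{n-1}(I_1),i,\mathrm{c}_1(I_2),\dots,\mathrm{c}_{m-1}(I_2))$. Moreover, if $\mathrm{size}(I_1)=0$ then $I_1\prec I_2=I_2$ and $\mathrm{CV}(I_1\prec I_2)=\mathrm{CV}(I_2)$; if $\mathrm{size}(I_2)=0$ then $I_1\succ_i I_2=I_1$ and $\mathrm{CV}(I_1\succ_i I_2)=\mathrm{CV}(I_1)$.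
   Context: An interval-poset of size $n$ is a partial order $\triangleleft$ on $\{1,\dots,n\}$ with $a\triangleleft c\Rightarrow b\triangleleft c$ and $c\triangleleft a\Rightarrow b\triangleleft a$ for all $a<b<c$. It corresponds to a Tamari interval $[T_1,T_2]$ of binary trees (nodes $v_1,\dots,v_n$ in in-order) via: for $a<b$, $b\triangleleft a$ iff $v_b$ is in the right subtree of $v_a$ in $T_1$, $a\triangleleft b$ iff $v_a$ is in the left subtree of $v_b$ in $T_2$. The lower bound Dyck path $D_1$ satisfies $\mathrm{tree}(D_1)=T_1$, where $\mathrm{tree}(D'1D''0)$ has left subtree $\mathrm{tree}(D')$, right subtree $\mathrm{tree}(D'')$. For a Dyck path $D$ of size $n$: $\mathrm{contacts}(D)$ = number of points at height $0$ except the last; $\mathrm{contacts}_i(D)$ = number of non-final contacts of the Dyck subpath strictly between the $i$-th up-step and its matching down-step. For an interval-poset $I$ with lower bound $D_1$: $\mathrm{contacts}(I)=\mathrm{contacts}(D_1)$, $\mathrm{c}_i(I)=\mathrm{contacts}_i(D_1)$, and $\mathrm{CV}(I)=(\mathrm{contacts}(I),\mathrm{c}_1(I),\dots,\mathrm{c}_{n-1}(I))$. Grafting: for interval-posets $I_1,I_2$ of sizes $n_1,n_2$, the shifted concatenation is the poset on $\{1,\dots,n_1+n_2\}$ with the relations of $I_1$ and those of $I_2$ shifted by $n_1$. For $n_2>0$, the left grafting $I_1\prec I_2$ is the shifted concatenation plus the relations $y\triangleleft n_1+1$ for all $y\le n_1$. For $n_1>0$ and $0\le r\le c$, where $y_1<\dots<y_c$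 are the decreasing roots of $I_2$ (vertices $b$ with no $a<b$, $b\triangleleft a$), shifted by $n_1$, the right grafting $I_1\succ_r I_2$ is the shifted concatenation plus the relations $y_i\triangleleft n_1$ for $1\le i\le r$. -}

module Defs where

open import Data.Nat using (ℕ; zero; suc; _+_; _∸_; _≤_; _<_; pred; _≟_)
open import Data.Bool using (Bool; true; false; if_then_else_)
open import Data.List using (List; []; _∷_; _++_; map; filter; length; upTo; take)
open import Data.List.Relation.Unary.All using (All; all?)
open import Data.List.Membership.Propositional using (_∈_)
open import Data.Product using (_×_)
open import Relation.Nullary using (Dec; ¬_; ¬?)
open import Relation.Binary.PropositionalEquality using (_≡_)
open import Relation.Binary.Construct.Closure.Transitive using (TransClosure)
open import Function.Bundles using (_⇔_)

-- Interval-posets of size n, on the vertex set {1,…,n} ⊆ ℕ.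
-- The relation x ◁ y is a (decidable) predicate on ℕ that only holds
-- between elements of {1,…,n}.

record IntervalPoset : Set₁ where
  field
    size      : ℕ
    _◁_       : ℕ → ℕ → Set
    ◁-dec     : ∀ x y → Dec (x ◁ y)
    ◁-dom     : ∀ {x y} → x ◁ y → (1 ≤ x × x ≤ size) × (1 ≤ y × y ≤ size)
    ◁-refl    : ∀ x → 1 ≤ x → x ≤ size → x ◁ x
    ◁-antisym : ∀ {x y} → x ◁ y → y ◁ x → x ≡ y
    ◁-trans   : ∀ {x y z} → x ◁ y → y ◁ z → x ◁ z
    ◁-int₁    : ∀ {a b c} → a < b → b < c → a ◁ c → b ◁ c
    ◁-int₂    : ∀ {a b c} → a < b → b < c → c ◁ a → b ◁ a

open IntervalPoset public

data Tree : Set where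
  leaf : Tree
  node : Tree → Tree → Tree

tsize : Tree → ℕ
tsize leaf       = 0
tsize (node l r) = suc (tsize l + tsize r)

-- RightDesc T a b : (with nodes labelled 1..tsize T in in-order)
-- node v_b lies in the right subtree of node v_a.
data RightDesc : Tree → ℕ → ℕ → Set where
  here : ∀ {l r b} → suc (tsize l) < b → b ≤ suc (tsize l + tsize r) →
         RightDesc (node l r) (suc (tsize l)) b
  inL  : ∀ {l r a b} → RightDesc l a b → RightDesc (node l r) a b
  inR  : ∀ {l r a b} → RightDesc r a b →
         RightDesc (node l r) (suc (tsize l) + a) (suc (tsize l) + b)

-- Dyck paths as words: true = up-step 1, false = down-step 0.
Step : Set
Step = Bool

-- dyck T is the unique Dyck path D with tree(D) = T,
-- following tree(D' 1 D'' 0) = node (tree D') (tree D'').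
dyck : Tree → List Step
dyck leaf       = []
dyck (node l r) = dyck l ++ (true ∷ dyck r ++ (false ∷ []))

-- T is the lower tree T₁ of a relation ◁ on {1..N}:
-- for a < b, b ◁ a iff v_b is in the right subtree of v_a in T.
IsLowerTree : ℕ → (ℕ → ℕ → Set) → Tree → Set
IsLowerTree N _◁_ T =
  (tsize T ≡ N) × (∀ a b → 1 ≤ a → a < b → b ≤ N → (b ◁ a) ⇔ RightDesc T a b)

heightsBefore : ℕ → List Step → List ℕ
heightsBefore h []          = []
heightsBefore h (s ∷ w) = h ∷ heightsBefore (if s then suc h else pred h) w

-- number of points at height 0 except the last one
contacts : List Step → ℕ
contacts w = length (filter (_≟ 0) (heightsBefore 0 w))

-- suffix of the word after its (k+1)-th up-step
afterUp : ℕ → List Step → List Step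
afterUp k       []          = []
afterUp k       (false ∷ w) = afterUp k w
afterUp zero    (true ∷ w)  = w
afterUp (suc k) (true ∷ w)  = afterUp k w

-- prefix of the word up to (excluding) the down-step going below
-- the starting height (the step matching the preceding up-step)
matched : ℕ → List Step → List Step
matched h       []          = []
matched h       (true ∷ w)  = true ∷ matched (suc h) w
matched zero    (false ∷ w) = []
matched (suc h) (false ∷ w) = false ∷ matched h w

-- contacts_i(D), i ≥ 1: contacts of the subpath strictly between the
-- i-th up-step and its matching down-step
contactsᵢ : List Step → ℕ → ℕ
contactsᵢ w i = contacts (matched 0 (afterUp (i ∸ 1) w))

cs : List Step → ℕ → List ℕ
cs w n = map (λ j → contactsᵢ w (suc j)) (upTo (n ∸ 1))

CV : List Step → ℕ → List ℕ
CV w n = contacts w ∷ cs w n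

data ShiftConcat (I₁ I₂ : IntervalPoset) : ℕ → ℕ → Set where
  fst : ∀ {x y} → _◁_ I₁ x y → ShiftConcat I₁ I₂ x y
  snd : ∀ {x y} → _◁_ I₂ x y → ShiftConcat I₁ I₂ (size I₁ + x) (size I₁ + y)

data LeftGraftGen (I₁ I₂ : IntervalPoset) : ℕ → ℕ → Set where
  old : ∀ {x y} → ShiftConcat I₁ I₂ x y → LeftGraftGen I₁ I₂ x y
  new : ∀ {y} → 1 ≤ y → y ≤ size I₁ → LeftGraftGen I₁ I₂ y (suc (size I₁))

_≺_ : IntervalPoset → IntervalPoset → ℕ → ℕ → Set
(I₁ ≺ I₂) = TransClosure (LeftGraftGen I₁ I₂)

IsDecRoot : IntervalPoset → ℕ → Set
IsDecRoot I b = All (λ a → ¬ (_◁_ I b a)) (upTo b)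

isDecRoot? : (I : IntervalPoset) → ∀ b → Dec (IsDecRoot I b)
isDecRoot? I b = all? (λ a → ¬? (◁-dec I b a)) (upTo b)

decRoots : IntervalPoset → List ℕ
decRoots I = filter (isDecRoot? I) (map suc (upTo (size I)))

data RightGraftGen (I₁ I₂ : IntervalPoset) (r : ℕ) : ℕ → ℕ → Set where
  old : ∀ {x y} → ShiftConcat I₁ I₂ x y → RightGraftGen I₁ I₂ r x y
  new : ∀ {y} → y ∈ take r (decRoots I₂) →
        RightGraftGen I₁ I₂ r (size I₁ + y) (size I₁)

_≻[_]_ : IntervalPoset → ℕ → IntervalPoset → ℕ → ℕ → Set
(I₁ ≻[ r ] I₂) = TransClosure (RightGraftGen I₁ I₂ r)

module Submission where

-- Everything is reduced to the lower binary trees.  (i) For a tree T, contacts(dyck T) is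
-- the length of the left branch of T, and c_j(dyck T) is the left-branch length of the
-- right subtree of the j-th node in in-order (`contacts-dyck`, `cs-dyck`).  (ii) Writing
-- T₂ = graftLeft A B (A sits at the bottom of the left branch of T₂), the tree obtained by
-- hanging A below the right branch of T₁ and grafting the result onto B satisfies the
-- contact formula with parameter leftSpine A (`contactFormula-graft`).  (iii) A tree is
-- determined by its right-descendant relation, so a relation has at most one lower tree
-- (`lowerTree-unique`).  (iv) Analysing the transitive closures defining the grafts, the
-- lower tree of I₁ ≺ I₂ is graftLeft T₁ T₂, and that of I₁ ≻[ i ] I₂ is the tree of (ii)
-- for a decomposition with leftSpine A = i; the latter uses that the decreasing roots of
-- I₂ are the nodes of the left branch of T₂ (`DecreasingRoots`).  (v) Grafting an empty
-- poset changes the relation only up to equivalence.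

open import Defs
open import Data.Nat using (ℕ; zero; suc; _+_; _∸_; _≤_; _<_; z≤n; s≤s; pred; _≟_; _≤?_)
open import Data.Nat.Properties
open import Data.Bool using (true; false)
open import Data.List using (List; []; _∷_; _++_; map; filter; length; upTo; take; _∷ʳ_; applyUpTo)
open import Data.List.Properties
  using ( ++-assoc; ++-identityʳ; map-++; map-cong; upTo-∷ʳ; map-upTo; length-++; ∷ʳ-injectiveˡ
        ; filter-++; filter-accept; filter-none; take++drop≡id)
open import Data.List.Membership.Propositional using (_∈_)
open import Data.List.Membership.Propositional.Properties using (∈-filter⁺; ∈-filter⁻; ∈-upTo⁺; ∈-upTo⁻; ∈-++⁺ˡ)
open import Data.List.Relation.Unary.Any using (here; there)
open import Data.List.Relation.Unary.All using (All; []; _∷_) renaming (tabulate to All-tabulate; lookup to All-lookup)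
open import Data.Product using (_×_; _,_; Σ; proj₁; proj₂)
open import Data.Sum using (_⊎_; inj₁; inj₂)
open import Data.Empty using (⊥; ⊥-elim)
open import Relation.Nullary using (Dec; ¬_; yes; no)
open import Relation.Binary.PropositionalEquality
open import Relation.Binary.Definitions using (tri<; tri≈; tri>)
open import Relation.Binary.Construct.Closure.Transitive using ([_]; _∷_)
open import Function.Bundles using (_⇔_; mk⇔)
open Function.Bundles.Equivalence using (to; from)

range : ℕ → ℕ → List ℕ
range a zero    = []
range a (suc k) = a ∷ range (suc a) k

range-+ : ∀ a k l → range a (k + l) ≡ range a k ++ range (a + k) l
range-+ a zero    l = cong (λ x → range x l) (sym (+-identityʳ a))
range-+ a (suc k) l = cong (a ∷_) (trans (range-+ (suc a) k l)
  (cong (λ x → range (suc a) k ++ range x l) (sym (+-suc a k))))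

map-range-shift : ∀ (f : ℕ → ℕ) a b k → map f (range (a + b) k) ≡ map (λ j → f (a + j)) (range b k)
map-range-shift f a b zero    = refl
map-range-shift f a b (suc k) =
  cong (f (a + b) ∷_) (trans (cong (λ x → map f (range x k)) (sym (+-suc a b))) (map-range-shift f a (suc b) k))

applyUpTo-range : ∀ (f : ℕ → ℕ) a k → (∀ i → f i ≡ a + i) → applyUpTo f k ≡ range a k
applyUpTo-range f a zero    f≗ = refl
applyUpTo-range f a (suc k) f≗ = cong₂ _∷_ (trans (f≗ 0) (+-identityʳ a))
  (applyUpTo-range (λ i → f (suc i)) (suc a) k (λ i → trans (f≗ (suc i)) (+-suc a i)))

upTo-range : ∀ k → upTo k ≡ range 0 k
upTo-range k = applyUpTo-range (λ i → i) 0 k (λ i → refl)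

map-suc-upTo : ∀ k → map suc (upTo k) ≡ range 1 k
map-suc-upTo k = trans (map-upTo suc k) (applyUpTo-range suc 1 k (λ i → refl))

∈-range⁻ : ∀ {y} a k → y ∈ range a k → (a ≤ y) × (y < a + k)
∈-range⁻ a (suc k) (here refl) = ≤-refl , m<m+n a (s≤s z≤n)
∈-range⁻ {y} a (suc k) (there y∈) with ∈-range⁻ (suc a) k y∈
... | a<y , y< = <⇒≤ a<y , subst (y <_) (sym (+-suc a k)) y<

∈-range⁺ : ∀ {y} a k → a ≤ y → y < a + k → y ∈ range a k
∈-range⁺ {y} a zero    a≤y y< = ⊥-elim (<-irrefl refl (≤-<-trans a≤y (subst (y <_) (+-identityʳ a) y<)))
∈-range⁺ {y} a (suc k) a≤y y< with a ≟ y
... | yes refl = here refl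
... | no  a≢y  = there (∈-range⁺ (suc a) k (≤∧≢⇒< a≤y a≢y) (subst (y <_) (+-suc a k) y<))

All-range : ∀ {Q : ℕ → Set} a k → (∀ y → a ≤ y → y < a + k → Q y) → All Q (range a k)
All-range a zero    q = []
All-range a (suc k) q = q a ≤-refl (m<m+n a (s≤s z≤n))
  ∷ All-range (suc a) k (λ y a<y y< → q y (<⇒≤ a<y) (subst (y <_) (sym (+-suc a k)) y<))

take-++-length : ∀ {A : Set} (xs ys : List A) k → length xs ≡ k → take k (xs ++ ys) ≡ xs
take-++-length []       ys zero    _  = refl
take-++-length (x ∷ xs) ys (suc k) eq = cong (x ∷_) (take-++-length xs ys k (suc-injective eq))

∈-take⁻ : ∀ {A : Set} {y : A} k xs → y ∈ take k xs → y ∈ xs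
∈-take⁻ {y = y} k xs y∈ = subst (y ∈_) (take++drop≡id k xs) (∈-++⁺ˡ y∈)

leftSpine : Tree → ℕ
leftSpine leaf       = 0
leftSpine (node l r) = suc (leftSpine l)

rightSpines : Tree → List ℕ
rightSpines leaf       = []
rightSpines (node l r) = rightSpines l ++ (leftSpine r ∷ rightSpines r)

dyck-node-++ : ∀ l r zs → dyck (node l r) ++ zs ≡ dyck l ++ (true ∷ dyck r ++ (false ∷ zs))
dyck-node-++ l r zs = trans (++-assoc (dyck l) _ zs)
  (cong (λ X → dyck l ++ (true ∷ X)) (++-assoc (dyck r) (false ∷ []) zs))

finalHeight : ℕ → List Step → ℕ
finalHeight h []          = h
finalHeight h (true ∷ w)  = finalHeight (suc h) w
finalHeight h (false ∷ w) = finalHeight (pred h) w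

finalHeight-++ : ∀ h xs ys → finalHeight h (xs ++ ys) ≡ finalHeight (finalHeight h xs) ys
finalHeight-++ h []           ys = refl
finalHeight-++ h (true ∷ xs)  ys = finalHeight-++ (suc h) xs ys
finalHeight-++ h (false ∷ xs) ys = finalHeight-++ (pred h) xs ys

finalHeight-dyck : ∀ T h → finalHeight h (dyck T) ≡ h
finalHeight-dyck leaf       h = refl
finalHeight-dyck (node l r) h = begin
  finalHeight h (dyck l ++ (true ∷ dyck r ++ (false ∷ [])))
    ≡⟨ finalHeight-++ h (dyck l) _ ⟩
  finalHeight (finalHeight h (dyck l)) (true ∷ dyck r ++ (false ∷ []))
    ≡⟨ cong (λ x → finalHeight x (true ∷ dyck r ++ (false ∷ []))) (finalHeight-dyck l h) ⟩
  finalHeight (suc h) (dyck r ++ (false ∷ []))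
    ≡⟨ finalHeight-++ (suc h) (dyck r) (false ∷ []) ⟩
  pred (finalHeight (suc h) (dyck r))
    ≡⟨ cong pred (finalHeight-dyck r (suc h)) ⟩
  h ∎
  where open ≡-Reasoning

heightsBefore-++ : ∀ h xs ys →
  heightsBefore h (xs ++ ys) ≡ heightsBefore h xs ++ heightsBefore (finalHeight h xs) ys
heightsBefore-++ h []           ys = refl
heightsBefore-++ h (true ∷ xs)  ys = cong (h ∷_) (heightsBefore-++ (suc h) xs ys)
heightsBefore-++ h (false ∷ xs) ys = cong (h ∷_) (heightsBefore-++ (pred h) xs ys)

zeros : ℕ → List Step → ℕ
zeros h w = length (filter (_≟ 0) (heightsBefore h w))

zeros-++ : ∀ h xs ys → zeros h (xs ++ ys) ≡ zeros h xs + zeros (finalHeight h xs) ys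
zeros-++ h xs ys = begin
  length (filter (_≟ 0) (heightsBefore h (xs ++ ys)))
    ≡⟨ cong (λ hs → length (filter (_≟ 0) hs)) (heightsBefore-++ h xs ys) ⟩
  length (filter (_≟ 0) (heightsBefore h xs ++ heightsBefore (finalHeight h xs) ys))
    ≡⟨ cong length (filter-++ (_≟ 0) (heightsBefore h xs) _) ⟩
  length (filter (_≟ 0) (heightsBefore h xs) ++ filter (_≟ 0) (heightsBefore (finalHeight h xs) ys))
    ≡⟨ length-++ (filter (_≟ 0) (heightsBefore h xs)) ⟩
  zeros h xs + zeros (finalHeight h xs) ys ∎
  where open ≡-Reasoning

zeros-node : ∀ h l r → zeros h (dyck (node l r))
  ≡ zeros h (dyck l) + (zeros h (true ∷ []) + (zeros (suc h) (dyck r) + zeros (suc h) (false ∷ [])))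
zeros-node h l r = begin
  zeros h (dyck l ++ (true ∷ dyck r ++ (false ∷ [])))
    ≡⟨ zeros-++ h (dyck l) _ ⟩
  zeros h (dyck l) + zeros (finalHeight h (dyck l)) ((true ∷ []) ++ dyck r ++ (false ∷ []))
    ≡⟨ cong (λ x → zeros h (dyck l) + zeros x ((true ∷ []) ++ dyck r ++ (false ∷ []))) (finalHeight-dyck l h) ⟩
  zeros h (dyck l) + zeros h ((true ∷ []) ++ dyck r ++ (false ∷ []))
    ≡⟨ cong (zeros h (dyck l) +_) (zeros-++ h (true ∷ []) _) ⟩
  zeros h (dyck l) + (zeros h (true ∷ []) + zeros (suc h) (dyck r ++ (false ∷ [])))
    ≡⟨ cong (λ x → zeros h (dyck l) + (zeros h (true ∷ []) + x)) (zeros-++ (suc h) (dyck r) _) ⟩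
  zeros h (dyck l) + (zeros h (true ∷ []) + (zeros (suc h) (dyck r) + zeros (finalHeight (suc h) (dyck r)) (false ∷ [])))
    ≡⟨ cong (λ x → zeros h (dyck l) + (zeros h (true ∷ []) + (zeros (suc h) (dyck r) + zeros x (false ∷ []))))
            (finalHeight-dyck r (suc h)) ⟩
  zeros h (dyck l) + (zeros h (true ∷ []) + (zeros (suc h) (dyck r) + zeros (suc h) (false ∷ []))) ∎
  where open ≡-Reasoning

zeros-dyck-positive : ∀ T h → zeros (suc h) (dyck T) ≡ 0
zeros-dyck-positive leaf       h = refl
zeros-dyck-positive (node l r) h
  rewrite zeros-node (suc h) l r | zeros-dyck-positive l h | zeros-dyck-positive r (suc h) = refl

contacts-dyck : ∀ T → contacts (dyck T) ≡ leftSpine T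
contacts-dyck leaf       = refl
contacts-dyck (node l r)
  rewrite zeros-node 0 l r | zeros-dyck-positive r 0 | contacts-dyck l = +-comm (leftSpine l) 1

ups : List Step → ℕ
ups []          = 0
ups (true ∷ w)  = suc (ups w)
ups (false ∷ w) = ups w

ups-++ : ∀ xs ys → ups (xs ++ ys) ≡ ups xs + ups ys
ups-++ []           ys = refl
ups-++ (true ∷ xs)  ys = cong suc (ups-++ xs ys)
ups-++ (false ∷ xs) ys = ups-++ xs ys

ups-dyck : ∀ T → ups (dyck T) ≡ tsize T
ups-dyck leaf       = refl
ups-dyck (node l r) = begin
  ups (dyck l ++ (true ∷ dyck r ++ (false ∷ [])))  ≡⟨ ups-++ (dyck l) _ ⟩
  ups (dyck l) + suc (ups (dyck r ++ (false ∷ []))) ≡⟨ cong (λ x → ups (dyck l) + suc x) (ups-++ (dyck r) _) ⟩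
  ups (dyck l) + suc (ups (dyck r) + 0)             ≡⟨ cong₂ (λ x y → x + suc y) (ups-dyck l) (trans (+-identityʳ _) (ups-dyck r)) ⟩
  tsize l + suc (tsize r)                           ≡⟨ +-suc (tsize l) (tsize r) ⟩
  suc (tsize l + tsize r)                           ∎
  where open ≡-Reasoning

afterUp-skip : ∀ j xs ys → afterUp (ups xs + j) (xs ++ ys) ≡ afterUp j ys
afterUp-skip j []           ys = refl
afterUp-skip j (true ∷ xs)  ys = afterUp-skip j xs ys
afterUp-skip j (false ∷ xs) ys = afterUp-skip j xs ys

afterUp-skip-dyck : ∀ T j ys → afterUp (tsize T + j) (dyck T ++ ys) ≡ afterUp j ys
afterUp-skip-dyck T j ys =
  trans (cong (λ k → afterUp (k + j) (dyck T ++ ys)) (sym (ups-dyck T))) (afterUp-skip j (dyck T) ys)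

-- A complete Dyck word never goes below its starting height, so `matched` passes it.
matched-dyck : ∀ h T zs → matched h (dyck T ++ zs) ≡ dyck T ++ matched h zs
matched-dyck h leaf       zs = refl
matched-dyck h (node l r) zs = begin
  matched h (dyck (node l r) ++ zs)                       ≡⟨ cong (matched h) (dyck-node-++ l r zs) ⟩
  matched h (dyck l ++ (true ∷ dyck r ++ (false ∷ zs)))   ≡⟨ matched-dyck h l _ ⟩
  dyck l ++ (true ∷ matched (suc h) (dyck r ++ (false ∷ zs)))
    ≡⟨ cong (λ X → dyck l ++ (true ∷ X)) (matched-dyck (suc h) r (false ∷ zs)) ⟩
  dyck l ++ (true ∷ dyck r ++ (false ∷ matched h zs))     ≡⟨ dyck-node-++ l r (matched h zs) ⟨
  dyck (node l r) ++ matched h zs                         ∎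
  where open ≡-Reasoning

-- contactAt w j = contacts_{j+1}(w).
contactAt : List Step → ℕ → ℕ
contactAt w j = contacts (matched 0 (afterUp j w))

contactAt-dyck : ∀ T ys → map (contactAt (dyck T ++ ys)) (range 0 (tsize T)) ≡ rightSpines T
contactAt-dyck leaf       ys = refl
contactAt-dyck (node l r) ys = begin
  map (contactAt (dyck (node l r) ++ ys)) (range 0 (suc (tsize l + tsize r)))
    ≡⟨ cong₂ (λ W k → map (contactAt W) k) (dyck-node-++ l r ys)
             (trans (cong (range 0) (sym (+-suc (tsize l) (tsize r)))) (range-+ 0 (tsize l) (suc (tsize r)))) ⟩
  map (contactAt W) (range 0 (tsize l) ++ (tsize l ∷ range (suc (tsize l)) (tsize r)))
    ≡⟨ map-++ (contactAt W) (range 0 (tsize l)) _ ⟩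
  map (contactAt W) (range 0 (tsize l)) ++ (contactAt W (tsize l) ∷ map (contactAt W) (range (suc (tsize l)) (tsize r)))
    ≡⟨ cong₂ (λ X Y → X ++ (contactAt W (tsize l) ∷ Y)) (contactAt-dyck l (true ∷ Zs)) right ⟩
  rightSpines l ++ (contactAt W (tsize l) ∷ rightSpines r)
    ≡⟨ cong (λ x → rightSpines l ++ (x ∷ rightSpines r)) root ⟩
  rightSpines l ++ (leftSpine r ∷ rightSpines r) ∎
  where
  open ≡-Reasoning
  Zs W : List Step
  Zs = dyck r ++ (false ∷ ys)
  W  = dyck l ++ (true ∷ Zs)
  -- the up-step of the root encloses exactly dyck r
  root : contactAt W (tsize l) ≡ leftSpine r
  root = begin
    contacts (matched 0 (afterUp (tsize l) W))
      ≡⟨ cong (λ k → contacts (matched 0 (afterUp k W))) (sym (+-identityʳ (tsize l))) ⟩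
    contacts (matched 0 (afterUp (tsize l + 0) W))
      ≡⟨ cong (λ X → contacts (matched 0 X)) (afterUp-skip-dyck l 0 (true ∷ Zs)) ⟩
    contacts (matched 0 (dyck r ++ (false ∷ ys)))
      ≡⟨ cong contacts (trans (matched-dyck 0 r (false ∷ ys)) (++-identityʳ (dyck r))) ⟩
    contacts (dyck r)
      ≡⟨ contacts-dyck r ⟩
    leftSpine r ∎
  -- the up-steps after the root are those of dyck r
  right : map (contactAt W) (range (suc (tsize l)) (tsize r)) ≡ rightSpines r
  right = begin
    map (contactAt W) (range (suc (tsize l)) (tsize r))
      ≡⟨ cong (λ a → map (contactAt W) (range a (tsize r))) (+-identityʳ (suc (tsize l))) ⟨
    map (contactAt W) (range (suc (tsize l) + 0) (tsize r))
      ≡⟨ map-range-shift (contactAt W) (suc (tsize l)) 0 (tsize r) ⟩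
    map (λ j → contactAt W (suc (tsize l) + j)) (range 0 (tsize r))
      ≡⟨ map-cong (λ j → cong (λ X → contacts (matched 0 X))
                    (trans (cong (λ k → afterUp k W) (sym (+-suc (tsize l) j))) (afterUp-skip-dyck l (suc j) _)))
                  (range 0 (tsize r)) ⟩
    map (contactAt (dyck r ++ (false ∷ ys))) (range 0 (tsize r))
      ≡⟨ contactAt-dyck r (false ∷ ys) ⟩
    rightSpines r ∎

cs-dyck : ∀ T p x → rightSpines T ≡ p ∷ʳ x → cs (dyck T) (tsize T) ≡ p
cs-dyck leaf       []      x ()
cs-dyck leaf       (_ ∷ _) x ()
cs-dyck (node l r) p x eq = ∷ʳ-injectiveˡ (map (contactAt D) (upTo k)) p (begin
  map (contactAt D) (upTo k) ∷ʳ contactAt D k      ≡⟨ map-++ (contactAt D) (upTo k) (k ∷ []) ⟨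
  map (contactAt D) (upTo k ∷ʳ k)                  ≡⟨ cong (map (contactAt D)) (trans (upTo-∷ʳ k) (upTo-range (suc k))) ⟩
  map (contactAt D) (range 0 (suc k))              ≡⟨ cong (λ W → map (contactAt W) (range 0 (suc k))) (++-identityʳ D) ⟨
  map (contactAt (D ++ [])) (range 0 (suc k))      ≡⟨ contactAt-dyck (node l r) [] ⟩
  rightSpines (node l r)                           ≡⟨ eq ⟩
  p ∷ʳ x                                           ∎)
  where
  open ≡-Reasoning
  D : List Step
  D = dyck (node l r)
  k : ℕ
  k = tsize l + tsize r

-- graftLeft S B: replace the leftmost leaf of B by S (S's nodes come first in in-order).
graftLeft : Tree → Tree → Tree
graftLeft S leaf       = S
graftLeft S (node l r) = node (graftLeft S l) r

-- hangRight T A: replace the rightmost leaf of T by A (A's nodes come last in in-order).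
hangRight : Tree → Tree → Tree
hangRight leaf       A = A
hangRight (node l r) A = node l (hangRight r A)

graftLeft-assoc : ∀ S U B → graftLeft S (graftLeft U B) ≡ graftLeft (graftLeft S U) B
graftLeft-assoc S U leaf       = refl
graftLeft-assoc S U (node l r) = cong (λ X → node X r) (graftLeft-assoc S U l)

tsize-graftLeft : ∀ S B → tsize (graftLeft S B) ≡ tsize S + tsize B
tsize-graftLeft S leaf       = sym (+-identityʳ _)
tsize-graftLeft S (node l r) = begin
  suc (tsize (graftLeft S l) + tsize r) ≡⟨ cong (λ x → suc (x + tsize r)) (tsize-graftLeft S l) ⟩
  suc (tsize S + tsize l + tsize r)     ≡⟨ cong suc (+-assoc (tsize S) (tsize l) (tsize r)) ⟩
  suc (tsize S + (tsize l + tsize r))   ≡⟨ +-suc (tsize S) _ ⟨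
  tsize S + tsize (node l r)            ∎
  where open ≡-Reasoning

tsize-hangRight : ∀ T A → tsize (hangRight T A) ≡ tsize T + tsize A
tsize-hangRight leaf       A = refl
tsize-hangRight (node l r) A =
  cong suc (trans (cong (tsize l +_) (tsize-hangRight r A)) (sym (+-assoc (tsize l) _ _)))

leftSpine-graftLeft : ∀ S B → leftSpine (graftLeft S B) ≡ leftSpine S + leftSpine B
leftSpine-graftLeft S leaf       = sym (+-identityʳ _)
leftSpine-graftLeft S (node l r) =
  trans (cong suc (leftSpine-graftLeft S l)) (sym (+-suc (leftSpine S) (leftSpine l)))

leftSpine-hangRight : ∀ T A → 0 < tsize T → leftSpine (hangRight T A) ≡ leftSpine T
leftSpine-hangRight (node l r) A _ = refl

rightSpines-graftLeft : ∀ S B → rightSpines (graftLeft S B) ≡ rightSpines S ++ rightSpines B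
rightSpines-graftLeft S leaf       = sym (++-identityʳ (rightSpines S))
rightSpines-graftLeft S (node l r) =
  trans (cong (_++ (leftSpine r ∷ rightSpines r)) (rightSpines-graftLeft S l))
        (++-assoc (rightSpines S) (rightSpines l) _)

-- The last node of a nonempty tree has an empty right subtree (entry 0); hanging A
-- there replaces that entry by leftSpine A and appends the entries of A.
rightSpines-hangRight : ∀ T → 0 < tsize T → Σ (List ℕ) λ p →
  (rightSpines T ≡ p ∷ʳ 0) × (∀ A → rightSpines (hangRight T A) ≡ p ++ (leftSpine A ∷ rightSpines A))
rightSpines-hangRight (node l leaf)       _ = rightSpines l , refl , λ A → refl
rightSpines-hangRight (node l (node a b)) _ with rightSpines-hangRight (node a b) (s≤s z≤n)
... | p , last , hang = rightSpines l ++ (leftSpine (node a b) ∷ p) ,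
  trans (cong (λ X → rightSpines l ++ (leftSpine (node a b) ∷ X)) last) (sym (++-assoc (rightSpines l) _ (0 ∷ []))) ,
  λ A → trans (cong (λ X → rightSpines l ++ (leftSpine (node a b) ∷ X)) (hang A)) (sym (++-assoc (rightSpines l) _ _))

ContactFormula : (T T₁ T₂ : Tree) (i n m : ℕ) → Set
ContactFormula T T₁ T₂ i n m =
  (contacts (dyck T) ≡ contacts (dyck T₁) + contacts (dyck T₂) ∸ i)
  × (CV (dyck T) (n + m) ≡ (contacts (dyck T₁) + contacts (dyck T₂) ∸ i) ∷ (cs (dyck T₁) n ++ (i ∷ cs (dyck T₂) m)))

contactFormula-graft : ∀ {T T₁ T₂} A B → T ≡ graftLeft (hangRight T₁ A) B → graftLeft A B ≡ T₂ →
  0 < tsize T₁ → 0 < tsize T₂ → ContactFormula T T₁ T₂ (leftSpine A) (tsize T₁) (tsize T₂)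
contactFormula-graft {T₁ = T₁} A B refl refl T₁>0 T₂>0
  with rightSpines-hangRight T₁ T₁>0 | rightSpines-hangRight (graftLeft A B) T₂>0
... | p , T₁-last , T₁-hang | q , T₂-last , _ = contacts-eq , cong₂ _∷_ contacts-eq cs-eq
  where
  open ≡-Reasoning
  T T₂ : Tree
  T  = graftLeft (hangRight T₁ A) B
  T₂ = graftLeft A B
  contacts-eq : contacts (dyck T) ≡ contacts (dyck T₁) + contacts (dyck T₂) ∸ leftSpine A
  contacts-eq = begin
    contacts (dyck T)                                   ≡⟨ contacts-dyck T ⟩
    leftSpine T                                         ≡⟨ leftSpine-graftLeft (hangRight T₁ A) B ⟩
    leftSpine (hangRight T₁ A) + leftSpine B            ≡⟨ cong (_+ leftSpine B) (leftSpine-hangRight T₁ A T₁>0) ⟩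
    leftSpine T₁ + leftSpine B                          ≡⟨ cong₂ _+_ (contacts-dyck T₁) (m+n∸m≡n (leftSpine A) (leftSpine B)) ⟨
    contacts (dyck T₁) + (leftSpine A + leftSpine B ∸ leftSpine A)
      ≡⟨ +-∸-assoc (contacts (dyck T₁)) (m≤m+n (leftSpine A) (leftSpine B)) ⟨
    contacts (dyck T₁) + (leftSpine A + leftSpine B) ∸ leftSpine A
      ≡⟨ cong (λ x → contacts (dyck T₁) + x ∸ leftSpine A) (trans (contacts-dyck T₂) (leftSpine-graftLeft A B)) ⟨
    contacts (dyck T₁) + contacts (dyck T₂) ∸ leftSpine A ∎
  size-eq : tsize T ≡ tsize T₁ + tsize T₂
  size-eq = begin
    tsize T                                  ≡⟨ tsize-graftLeft (hangRight T₁ A) B ⟩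
    tsize (hangRight T₁ A) + tsize B         ≡⟨ cong (_+ tsize B) (tsize-hangRight T₁ A) ⟩
    tsize T₁ + tsize A + tsize B             ≡⟨ +-assoc (tsize T₁) (tsize A) (tsize B) ⟩
    tsize T₁ + (tsize A + tsize B)           ≡⟨ cong (tsize T₁ +_) (tsize-graftLeft A B) ⟨
    tsize T₁ + tsize T₂                      ∎
  spines-eq : rightSpines T ≡ (p ++ (leftSpine A ∷ q)) ∷ʳ 0
  spines-eq = begin
    rightSpines T                                          ≡⟨ rightSpines-graftLeft (hangRight T₁ A) B ⟩
    rightSpines (hangRight T₁ A) ++ rightSpines B          ≡⟨ cong (_++ rightSpines B) (T₁-hang A) ⟩
    (p ++ (leftSpine A ∷ rightSpines A)) ++ rightSpines B  ≡⟨ ++-assoc p _ (rightSpines B) ⟩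
    p ++ (leftSpine A ∷ rightSpines A ++ rightSpines B)    ≡⟨ cong (λ X → p ++ (leftSpine A ∷ X)) (rightSpines-graftLeft A B) ⟨
    p ++ (leftSpine A ∷ rightSpines T₂)                    ≡⟨ cong (λ X → p ++ (leftSpine A ∷ X)) T₂-last ⟩
    p ++ (leftSpine A ∷ q ∷ʳ 0)                            ≡⟨ ++-assoc p (leftSpine A ∷ q) (0 ∷ []) ⟨
    (p ++ (leftSpine A ∷ q)) ∷ʳ 0                          ∎
  cs-eq : cs (dyck T) (tsize T₁ + tsize T₂) ≡ cs (dyck T₁) (tsize T₁) ++ (leftSpine A ∷ cs (dyck T₂) (tsize T₂))
  cs-eq = begin
    cs (dyck T) (tsize T₁ + tsize T₂)   ≡⟨ cong (cs (dyck T)) size-eq ⟨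
    cs (dyck T) (tsize T)               ≡⟨ cs-dyck T _ 0 spines-eq ⟩
    p ++ (leftSpine A ∷ q)              ≡⟨ cong₂ (λ X Y → X ++ (leftSpine A ∷ Y)) (cs-dyck T₁ p 0 T₁-last) (cs-dyck T₂ q 0 T₂-last) ⟨
    cs (dyck T₁) (tsize T₁) ++ (leftSpine A ∷ cs (dyck T₂) (tsize T₂)) ∎

rightDesc-bounds : ∀ {T a b} → RightDesc T a b → (1 ≤ a) × (a < b) × (b ≤ tsize T)
rightDesc-bounds (here a<b b≤) = s≤s z≤n , a<b , b≤
rightDesc-bounds {node l r} (inL d) with rightDesc-bounds d
... | 1≤a , a<b , b≤ = 1≤a , a<b , ≤-trans b≤ (≤-trans (m≤m+n (tsize l) (tsize r)) (n≤1+n _))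
rightDesc-bounds {node l r} (inR d) with rightDesc-bounds d
... | _ , a<b , b≤ = s≤s z≤n , +-monoʳ-< (suc (tsize l)) a<b , +-monoʳ-≤ (suc (tsize l)) b≤

rightDesc-lower : ∀ {T a b} → RightDesc T a b → 0 < b
rightDesc-lower d with rightDesc-bounds d
... | 1≤a , a<b , _ = <-trans 1≤a a<b

rightDesc-upper : ∀ {T a b} → RightDesc T a b → b ≤ tsize T
rightDesc-upper d = proj₂ (proj₂ (rightDesc-bounds d))

rightDesc-cast : ∀ {T a a′ b b′} → a ≡ a′ → b ≡ b′ → RightDesc T a b → RightDesc T a′ b′
rightDesc-cast refl refl d = d

-- The root is nobody's right descendant: it precedes its right subtree and follows its left one.
root-not-rightDesc : ∀ {l r x y} → RightDesc (node l r) x y → y ≢ suc (tsize l)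
root-not-rightDesc (here root<y _) refl = <-irrefl refl root<y
root-not-rightDesc (inL d)         refl = 1+n≰n (rightDesc-upper d)
root-not-rightDesc {l} (inR d)     eq   = <-irrefl (sym eq) (m<m+n (suc (tsize l)) (rightDesc-lower d))

rightDesc-left : ∀ {l r a b} → RightDesc (node l r) a b → b ≤ tsize l → RightDesc l a b
rightDesc-left (here root<b _) b≤ = ⊥-elim (1+n≰n (≤-trans (n≤1+n _) (≤-trans root<b b≤)))
rightDesc-left (inL d)         b≤ = d
rightDesc-left {l} (inR d)     b≤ = ⊥-elim (1+n≰n (≤-trans (s≤s (m≤m+n (tsize l) _)) b≤))

rightDesc-right : ∀ {l r x y a b} → RightDesc (node l r) x y →
  x ≡ suc (tsize l) + a → y ≡ suc (tsize l) + b → 1 ≤ a → RightDesc r a b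
rightDesc-right {l} (here _ _) x≡ _  1≤a = ⊥-elim (<-irrefl x≡ (m<m+n (suc (tsize l)) 1≤a))
rightDesc-right {l} (inL d)    _  y≡ _   =
  ⊥-elim (1+n≰n (≤-trans (s≤s (m≤m+n (tsize l) _)) (subst (_≤ tsize l) y≡ (rightDesc-upper d))))
rightDesc-right {l} (inR d)    x≡ y≡ _   =
  rightDesc-cast (+-cancelˡ-≡ (suc (tsize l)) _ _ x≡) (+-cancelˡ-≡ (suc (tsize l)) _ _ y≡) d

rightDesc-injective : ∀ T T′ → tsize T ≡ tsize T′ →
  (∀ {a b} → RightDesc T a b → RightDesc T′ a b) → (∀ {a b} → RightDesc T′ a b → RightDesc T a b) → T ≡ T′
rightDesc-injective leaf       leaf         _  _ _ = refl
rightDesc-injective (node l r) (node l′ r′) sz f g with <-cmp (tsize l) (tsize l′)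
... | tri< l<l′ _ _ =   -- the root of T would be a right descendant of the root of T′
  ⊥-elim (root-not-rightDesc (f (here (s≤s l<l′) (≤-trans (s≤s (m≤m+n (tsize l′) (tsize r′))) (≤-reflexive (sym sz))))) refl)
... | tri> _ _ l′<l =
  ⊥-elim (root-not-rightDesc (g (here (s≤s l′<l) (≤-trans (s≤s (m≤m+n (tsize l) (tsize r))) (≤-reflexive sz)))) refl)
... | tri≈ _ l≡l′ _ = cong₂ node
  (rightDesc-injective l l′ l≡l′
    (λ d → rightDesc-left (f (inL d)) (subst (_ ≤_) l≡l′ (rightDesc-upper d)))
    (λ d → rightDesc-left (g (inL d)) (subst (_ ≤_) (sym l≡l′) (rightDesc-upper d))))
  (rightDesc-injective r r′ (+-cancelˡ-≡ (tsize l) _ _ (trans (suc-injective sz) (cong (_+ tsize r′) (sym l≡l′))))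
    (λ d → rightDesc-right (f (inR d)) (shift l≡l′) (shift l≡l′) (proj₁ (rightDesc-bounds d)))
    (λ d → rightDesc-right (g (inR d)) (shift (sym l≡l′)) (shift (sym l≡l′)) (proj₁ (rightDesc-bounds d))))
  where
  shift : ∀ {k k′ x} → k ≡ k′ → suc k + x ≡ suc k′ + x
  shift {x = x} = cong (λ k → suc k + x)

lowerTree-cong : ∀ {N N′ R R′ T} → N ≡ N′ → (∀ x y → R x y ⇔ R′ x y) → IsLowerTree N R T → IsLowerTree N′ R′ T
lowerTree-cong refl R⇔R′ (szT , isT) = szT , λ a b 1≤a a<b b≤N →
  mk⇔ (λ r → to (isT a b 1≤a a<b b≤N) (from (R⇔R′ b a) r)) (λ d → to (R⇔R′ b a) (from (isT a b 1≤a a<b b≤N) d))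

lowerTree-rightDesc : ∀ {N R T a b} → IsLowerTree N R T → 1 ≤ a → a < b → b ≤ N → R b a → RightDesc T a b
lowerTree-rightDesc {a = a} {b} (_ , isT) 1≤a a<b b≤N r = to (isT a b 1≤a a<b b≤N) r

lowerTree-rel : ∀ {N R T a b} → IsLowerTree N R T → RightDesc T a b → R b a
lowerTree-rel {a = a} {b} (szT , isT) d with rightDesc-bounds d
... | 1≤a , a<b , b≤ = from (isT a b 1≤a a<b (subst (b ≤_) szT b≤)) d

lowerTree-unique : ∀ {N R T T′} → IsLowerTree N R T → IsLowerTree N R T′ → T ≡ T′
lowerTree-unique {T = T} {T′} LT LT′ =
  rightDesc-injective T T′ (trans (proj₁ LT) (sym (proj₁ LT′))) (transfer LT LT′) (transfer LT′ LT)
  where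
  transfer : ∀ {N R U U′ a b} → IsLowerTree N R U → IsLowerTree N R U′ → RightDesc U a b → RightDesc U′ a b
  transfer LU LU′ d with rightDesc-bounds d
  ... | 1≤a , a<b , b≤ = lowerTree-rightDesc LU′ 1≤a a<b (subst (_ ≤_) (proj₁ LU) b≤) (lowerTree-rel LU d)

data ShiftedDesc (k : ℕ) (B : Tree) (a b : ℕ) : Set where
  shifted : ∀ {a′ b′} → a ≡ k + a′ → b ≡ k + b′ → RightDesc B a′ b′ → ShiftedDesc k B a b

data InBlock (k m b : ℕ) : Set where
  block : ∀ {b′} → b ≡ k + b′ → 1 ≤ b′ → b′ ≤ m → InBlock k m b

inBlock-above : ∀ {k m b} → k < b → b ≤ k + m → InBlock k m b
inBlock-above {k} {m} {b} k<b b≤ = block (sym (m+[n∸m]≡n (<⇒≤ k<b))) (m<n⇒0<n∸m k<b)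
  (+-cancelˡ-≤ k _ _ (≤-trans (≤-reflexive (m+[n∸m]≡n (<⇒≤ k<b))) b≤))

data OnRightBranch : Tree → ℕ → Set where
  root  : ∀ {l r} → OnRightBranch (node l r) (suc (tsize l))
  right : ∀ {l r a} → OnRightBranch r a → OnRightBranch (node l r) (suc (tsize l) + a)

graftLeft-root : ∀ S l → suc (tsize (graftLeft S l)) ≡ tsize S + suc (tsize l)
graftLeft-root S l = trans (cong suc (tsize-graftLeft S l)) (sym (+-suc (tsize S) (tsize l)))

graftLeft-shift : ∀ S l x → suc (tsize (graftLeft S l)) + x ≡ tsize S + (suc (tsize l) + x)
graftLeft-shift S l x = trans (cong (_+ x) (graftLeft-root S l)) (+-assoc (tsize S) (suc (tsize l)) x)

rightDesc-graftLeft-inner : ∀ S B {a b} → RightDesc S a b → RightDesc (graftLeft S B) a b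
rightDesc-graftLeft-inner S leaf       d = d
rightDesc-graftLeft-inner S (node l r) d = inL (rightDesc-graftLeft-inner S l d)

rightDesc-graftLeft-outer : ∀ S {B a b} → RightDesc B a b → RightDesc (graftLeft S B) (tsize S + a) (tsize S + b)
rightDesc-graftLeft-outer S {node l r} (here {b = b} root<b b≤) = rightDesc-cast (graftLeft-root S l) refl
  (here (subst (_< tsize S + b) (sym (graftLeft-root S l)) (+-monoʳ-< (tsize S) root<b))
        (subst (tsize S + b ≤_) (sym (graftLeft-shift S l (tsize r))) (+-monoʳ-≤ (tsize S) b≤)))
rightDesc-graftLeft-outer S {node l r} (inL d) = inL (rightDesc-graftLeft-outer S d)
rightDesc-graftLeft-outer S {node l r} (inR {a = a} {b = b} d) =
  rightDesc-cast (graftLeft-shift S l a) (graftLeft-shift S l b) (inR d)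

rightDesc-graftLeft-inv : ∀ S B {a b} → RightDesc (graftLeft S B) a b → RightDesc S a b ⊎ ShiftedDesc (tsize S) B a b
rightDesc-graftLeft-inv S leaf d = inj₁ d
rightDesc-graftLeft-inv S (node l r) {b = b} (here root<b b≤) =
  inj₂ (shifted (graftLeft-root S l) (sym (m+[n∸m]≡n S≤b))
    (here (+-cancelˡ-< (tsize S) _ _ (subst₂ _<_ (graftLeft-root S l) (sym (m+[n∸m]≡n S≤b)) root<b))
          (+-cancelˡ-≤ (tsize S) _ _ (subst₂ _≤_ (sym (m+[n∸m]≡n S≤b)) (graftLeft-shift S l (tsize r)) b≤))))
  where
  S≤b : tsize S ≤ b
  S≤b = ≤-trans (≤-trans (m≤m+n (tsize S) (tsize l)) (≤-reflexive (sym (tsize-graftLeft S l)))) (<⇒≤ (<-trans (n<1+n _) root<b))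
rightDesc-graftLeft-inv S (node l r) (inL d) with rightDesc-graftLeft-inv S l d
... | inj₁ dS                    = inj₁ dS
... | inj₂ (shifted a≡ b≡ dB)    = inj₂ (shifted a≡ b≡ (inL dB))
rightDesc-graftLeft-inv S (node l r) (inR {a = a} {b = b} d) =
  inj₂ (shifted (graftLeft-shift S l a) (graftLeft-shift S l b) (inR d))

rightDesc-hangRight-inner : ∀ A {T a b} → RightDesc T a b → RightDesc (hangRight T A) a b
rightDesc-hangRight-inner A (here {l} {r} root<b b≤) = here root<b (≤-trans b≤ (s≤s (+-monoʳ-≤ (tsize l)
  (≤-trans (m≤m+n (tsize r) (tsize A)) (≤-reflexive (sym (tsize-hangRight r A)))))))
rightDesc-hangRight-inner A (inL d) = inL d
rightDesc-hangRight-inner A (inR d) = inR (rightDesc-hangRight-inner A d)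

hangRight-shift : ∀ l r x → suc (tsize l) + (tsize r + x) ≡ tsize (node l r) + x
hangRight-shift l r x = cong suc (sym (+-assoc (tsize l) (tsize r) x))

rightDesc-hangRight-outer : ∀ T A {a b} → RightDesc A a b → RightDesc (hangRight T A) (tsize T + a) (tsize T + b)
rightDesc-hangRight-outer leaf       A d = d
rightDesc-hangRight-outer (node l r) A {a} {b} d =
  rightDesc-cast (hangRight-shift l r a) (hangRight-shift l r b) (inR (rightDesc-hangRight-outer r A d))

rightDesc-hangRight-cross : ∀ {T} A {a b′} → OnRightBranch T a → 1 ≤ b′ → b′ ≤ tsize A →
  RightDesc (hangRight T A) a (tsize T + b′)
rightDesc-hangRight-cross A {b′ = b′} (root {l} {r}) 1≤b′ b′≤ = rightDesc-cast refl (hangRight-shift l r b′)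
  (here (s≤s (m<m+n (tsize l) (≤-trans 1≤b′ (m≤n+m b′ (tsize r)))))
        (s≤s (+-monoʳ-≤ (tsize l) (≤-trans (+-monoʳ-≤ (tsize r) b′≤) (≤-reflexive (sym (tsize-hangRight r A)))))))
rightDesc-hangRight-cross A {b′ = b′} (right {l} {r} ob) 1≤b′ b′≤ =
  rightDesc-cast refl (hangRight-shift l r b′) (inR (rightDesc-hangRight-cross A ob 1≤b′ b′≤))

rightDesc-hangRight-inv : ∀ T A {a b} → RightDesc (hangRight T A) a b →
  RightDesc T a b ⊎ (ShiftedDesc (tsize T) A a b ⊎ (OnRightBranch T a × InBlock (tsize T) (tsize A) b))
rightDesc-hangRight-inv leaf       A d = inj₂ (inj₁ (shifted refl refl d))
rightDesc-hangRight-inv (node l r) A {b = b} (here root<b b≤) with b ≤? tsize (node l r)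
... | yes b≤T = inj₁ (here root<b b≤T)
... | no  b≰T = inj₂ (inj₂ (root , inBlock-above (≰⇒> b≰T) (subst (b ≤_) (tsize-hangRight (node l r) A) b≤)))
rightDesc-hangRight-inv (node l r) A (inL d) = inj₁ (inL d)
rightDesc-hangRight-inv (node l r) A (inR d) with rightDesc-hangRight-inv r A d
... | inj₁ dr                                       = inj₁ (inR dr)
... | inj₂ (inj₁ (shifted {a′} {b′} a≡ b≡ dA))      =
  inj₂ (inj₁ (shifted (trans (cong (suc (tsize l) +_) a≡) (hangRight-shift l r a′))
                      (trans (cong (suc (tsize l) +_) b≡) (hangRight-shift l r b′)) dA))
... | inj₂ (inj₂ (ob , block {b′} b≡ 1≤b′ b′≤))    =
  inj₂ (inj₂ (right ob , block (trans (cong (suc (tsize l) +_) b≡) (hangRight-shift l r b′)) 1≤b′ b′≤))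

onRightBranch-last : ∀ T → 0 < tsize T → OnRightBranch T (tsize T)
onRightBranch-last (node l leaf)       _ = subst (OnRightBranch (node l leaf)) (cong suc (sym (+-identityʳ (tsize l)))) root
onRightBranch-last (node l (node x y)) _ = right (onRightBranch-last (node x y) (s≤s z≤n))

rightDesc-last⇒onRightBranch : ∀ {T a b} → RightDesc T a b → b ≡ tsize T → OnRightBranch T a
rightDesc-last⇒onRightBranch (here _ _)  _  = root
rightDesc-last⇒onRightBranch {node l r} (inL d) b≡ =
  ⊥-elim (1+n≰n (≤-trans (s≤s (m≤m+n (tsize l) (tsize r))) (subst (_≤ tsize l) b≡ (rightDesc-upper d))))
rightDesc-last⇒onRightBranch {node l r} (inR d) b≡ =
  right (rightDesc-last⇒onRightBranch d (+-cancelˡ-≡ (suc (tsize l)) _ _ b≡))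

onRightBranch⇒rightDesc-last : ∀ {T a} → OnRightBranch T a → a ≡ tsize T ⊎ RightDesc T a (tsize T)
onRightBranch⇒rightDesc-last (root {l} {leaf})     = inj₁ (cong suc (sym (+-identityʳ (tsize l))))
onRightBranch⇒rightDesc-last (root {l} {node x y}) = inj₂ (here (s≤s (m<m+n (tsize l) (s≤s z≤n))) ≤-refl)
onRightBranch⇒rightDesc-last (right {l} ob) with onRightBranch⇒rightDesc-last ob
... | inj₁ a≡ = inj₁ (cong (suc (tsize l) +_) a≡)
... | inj₂ d  = inj₂ (inR d)

◁-src-pos : ∀ I {x y} → _◁_ I x y → 1 ≤ x
◁-src-pos I p = proj₁ (proj₁ (◁-dom I p))

◁-src-bound : ∀ I {x y} → _◁_ I x y → x ≤ size I
◁-src-bound I p = proj₂ (proj₁ (◁-dom I p))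

◁-tgt-pos : ∀ I {x y} → _◁_ I x y → 1 ≤ y
◁-tgt-pos I p = proj₁ (proj₂ (◁-dom I p))

◁-tgt-bound : ∀ I {x y} → _◁_ I x y → y ≤ size I
◁-tgt-bound I p = proj₂ (proj₂ (◁-dom I p))

WeaklyBelow : IntervalPoset → ℕ → ℕ → Set
WeaklyBelow I x y = x ≡ y ⊎ _◁_ I x y

weaklyBelow-pos : ∀ I {x y} → 1 ≤ y → WeaklyBelow I x y → 1 ≤ x
weaklyBelow-pos I 1≤y (inj₁ refl) = 1≤y
weaklyBelow-pos I _   (inj₂ x◁y)  = ◁-src-pos I x◁y

◁-⊴-trans : ∀ I {x y r} → _◁_ I x y → WeaklyBelow I y r → _◁_ I x r
◁-⊴-trans I x◁y (inj₁ refl) = x◁y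
◁-⊴-trans I x◁y (inj₂ y◁r)  = ◁-trans I x◁y y◁r

beyond : ∀ {k x x′} → x ≡ k + x′ → 1 ≤ x′ → k < x
beyond {k} {x′ = x′} refl 1≤x′ = m<m+n k 1≤x′

decRoot-bounds : ∀ I k {y} → y ∈ take k (decRoots I) → (1 ≤ y) × (y ≤ size I)
decRoot-bounds I k {y} y∈ with ∈-range⁻ 1 (size I)
  (subst (y ∈_) (map-suc-upTo (size I)) (proj₁ (∈-filter⁻ (isDecRoot? I) (∈-take⁻ k (decRoots I) y∈))))
... | 1≤y , y< = 1≤y , ≤-pred y<

-- For an interval-poset I with lower tree T, a label is a decreasing root iff it is nobody's
-- right descendant in T.  For a decomposition T = graftLeft A B, the decreasing roots among
-- the labels of A are the nodes of the left branch of A, so they are the first leftSpine A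
-- decreasing roots, and every label of A lies weakly below one of them.
module DecreasingRoots (I : IntervalPoset) (T : Tree) (LT : IsLowerTree (size I) (_◁_ I) T) where

  RootIn : Tree → ℕ → Set
  RootIn A y = IsDecRoot I y × (1 ≤ y) × (y ≤ tsize A)

  -- A right descendant has a smaller vertex above it, so it is not a decreasing root.
  rightDesc⇒¬decRoot : ∀ {a y} → RightDesc T a y → ¬ IsDecRoot I y
  rightDesc⇒¬decRoot d isRoot = All-lookup isRoot (∈-upTo⁺ (proj₁ (proj₂ (rightDesc-bounds d)))) (lowerTree-rel LT d)

  ¬rightDesc⇒decRoot : ∀ {y} → y ≤ size I → (∀ {a} → ¬ RightDesc T a y) → IsDecRoot I y
  ¬rightDesc⇒decRoot {y} y≤ ¬d = All-tabulate notBelow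
    where
    notBelow : ∀ {a} → a ∈ upTo y → ¬ (_◁_ I y a)
    notBelow {zero}  _  y◁0 with () ← ◁-tgt-pos I y◁0
    notBelow {suc a} a∈ y◁a = ¬d (lowerTree-rightDesc LT (s≤s z≤n) (∈-upTo⁻ a∈) y≤ y◁a)

  module _ {A B : Tree} (split : graftLeft A B ≡ T) where

    split-size : tsize A ≤ size I
    split-size = ≤-trans (m≤m+n _ _) (≤-reflexive (trans (sym (tsize-graftLeft A B)) (trans (cong tsize split) (proj₁ LT))))

    split-inner : ∀ {a b} → RightDesc A a b → RightDesc T a b
    split-inner {a} {b} d = subst (λ U → RightDesc U a b) split (rightDesc-graftLeft-inner A B d)

    split-inv : ∀ {a b} → RightDesc T a b → RightDesc A a b ⊎ ShiftedDesc (tsize A) B a b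
    split-inv {a} {b} d = rightDesc-graftLeft-inv A B (subst (λ U → RightDesc U a b) (sym split) d)

  split-root-decRoot : ∀ A′ R B → graftLeft (node A′ R) B ≡ T → IsDecRoot I (suc (tsize A′))
  split-root-decRoot A′ R B split =
    ¬rightDesc⇒decRoot (≤-trans (s≤s (m≤m+n _ _)) (split-size split)) notRightDesc
    where
    notRightDesc : ∀ {a} → ¬ RightDesc T a (suc (tsize A′))
    notRightDesc d with split-inv split d
    ... | inj₁ dA                        = root-not-rightDesc dA refl
    ... | inj₂ (shifted {a′} a≡ _ dB) = <-irrefl refl (<-≤-trans (proj₁ (proj₂ (rightDesc-bounds d)))
            (≤-trans (s≤s (m≤m+n (tsize A′) (tsize R))) (≤-trans (m≤m+n _ a′) (≤-reflexive (sym a≡)))))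

  count-roots : ∀ A B → graftLeft A B ≡ T → length (filter (isDecRoot? I) (range 1 (tsize A))) ≡ leftSpine A
  count-roots leaf        B split = refl
  count-roots (node A′ R) B split = begin
    length (filter P? (range 1 (tsize (node A′ R))))
      ≡⟨ cong (λ xs → length (filter P? xs)) labels ⟩
    length (filter P? (range 1 (tsize A′) ++ (suc (tsize A′) ∷ rightLabels)))
      ≡⟨ cong length (filter-++ P? (range 1 (tsize A′)) _) ⟩
    length (filter P? (range 1 (tsize A′)) ++ filter P? (suc (tsize A′) ∷ rightLabels))
      ≡⟨ length-++ (filter P? (range 1 (tsize A′))) ⟩
    length (filter P? (range 1 (tsize A′))) + length (filter P? (suc (tsize A′) ∷ rightLabels))
      ≡⟨ cong₂ _+_ (count-roots A′ (graftLeft (node leaf R) B) (trans (graftLeft-assoc A′ (node leaf R) B) split))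
                   (cong length (trans (filter-accept P? (split-root-decRoot A′ R B split)) (cong (_ ∷_) (filter-none P? rightNotRoots)))) ⟩
    leftSpine A′ + 1
      ≡⟨ +-comm (leftSpine A′) 1 ⟩
    suc (leftSpine A′) ∎
    where
    open ≡-Reasoning
    P? : ∀ y → Dec (IsDecRoot I y)
    P? = isDecRoot? I
    rightLabels : List ℕ
    rightLabels = range (suc (suc (tsize A′))) (tsize R)
    labels : range 1 (tsize (node A′ R)) ≡ range 1 (tsize A′) ++ (suc (tsize A′) ∷ rightLabels)
    labels = trans (cong (range 1) (sym (+-suc (tsize A′) (tsize R)))) (range-+ 1 (tsize A′) (suc (tsize R)))
    -- the labels of R are right descendants of the root of node A′ R
    rightNotRoots : All (λ y → ¬ IsDecRoot I y) rightLabels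
    rightNotRoots = All-range _ (tsize R) λ y root<y y< →
      rightDesc⇒¬decRoot (split-inner split (here root<y (≤-pred y<)))

  firstRoots : ∀ A B → graftLeft A B ≡ T → take (leftSpine A) (decRoots I) ≡ filter (isDecRoot? I) (range 1 (tsize A))
  firstRoots A B split = begin
    take (leftSpine A) (filter P? (map suc (upTo (size I))))
      ≡⟨ cong (λ xs → take (leftSpine A) (filter P? xs)) (trans (map-suc-upTo (size I)) (cong (range 1) size≡)) ⟩
    take (leftSpine A) (filter P? (range 1 (tsize A + tsize B)))
      ≡⟨ cong (λ xs → take (leftSpine A) (filter P? xs)) (range-+ 1 (tsize A) (tsize B)) ⟩
    take (leftSpine A) (filter P? (range 1 (tsize A) ++ range (1 + tsize A) (tsize B)))
      ≡⟨ cong (take (leftSpine A)) (filter-++ P? (range 1 (tsize A)) _) ⟩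
    take (leftSpine A) (filter P? (range 1 (tsize A)) ++ filter P? (range (1 + tsize A) (tsize B)))
      ≡⟨ take-++-length _ _ (leftSpine A) (count-roots A B split) ⟩
    filter P? (range 1 (tsize A)) ∎
    where
    open ≡-Reasoning
    P? : ∀ y → Dec (IsDecRoot I y)
    P? = isDecRoot? I
    size≡ : size I ≡ tsize A + tsize B
    size≡ = trans (sym (proj₁ LT)) (trans (cong tsize (sym split)) (tsize-graftLeft A B))

  firstRoots-mem : ∀ {A B} → graftLeft A B ≡ T → ∀ {y} → y ∈ take (leftSpine A) (decRoots I) ⇔ RootIn A y
  firstRoots-mem {A} {B} split {y} = mk⇔ mem⇒ mem⇐
    where
    mem⇒ : y ∈ take (leftSpine A) (decRoots I) → RootIn A y
    mem⇒ y∈ with ∈-filter⁻ (isDecRoot? I) (subst (y ∈_) (firstRoots A B split) y∈)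
    ... | y∈A , isRoot with ∈-range⁻ 1 (tsize A) y∈A
    ...   | 1≤y , y< = isRoot , 1≤y , ≤-pred y<
    mem⇐ : RootIn A y → y ∈ take (leftSpine A) (decRoots I)
    mem⇐ (isRoot , 1≤y , y≤) =
      subst (y ∈_) (sym (firstRoots A B split)) (∈-filter⁺ (isDecRoot? I) (∈-range⁺ 1 (tsize A) 1≤y (s≤s y≤)) isRoot)

  below-root : ∀ A B → graftLeft A B ≡ T → ∀ {b} → 1 ≤ b → b ≤ tsize A →
    Σ ℕ λ y → RootIn A y × WeaklyBelow I b y
  below-root leaf        _ _     () z≤n
  below-root (node A′ R) B split {b} 1≤b b≤ with b ≤? tsize A′
  ... | yes b≤A′ with below-root A′ (graftLeft (node leaf R) B) (trans (graftLeft-assoc A′ (node leaf R) B) split) 1≤b b≤A′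
  ...   | y , (isRoot , 1≤y , y≤) , b≤y = y , (isRoot , 1≤y , ≤-trans y≤ (≤-trans (m≤m+n _ (tsize R)) (n≤1+n _))) , b≤y
  below-root (node A′ R) B split {b} 1≤b b≤ | no b≰A′ =
    suc (tsize A′) , (split-root-decRoot A′ R B split , s≤s z≤n , s≤s (m≤m+n _ _)) , b≤root
    where
    b≤root : WeaklyBelow I b (suc (tsize A′))
    b≤root with b ≟ suc (tsize A′)
    ... | yes b≡ = inj₁ b≡
    ... | no  b≢ = inj₂ (lowerTree-rel LT (split-inner split (here root<b b≤)))
      where
      root<b : suc (tsize A′) < b
      root<b = ≤∧≢⇒< (≰⇒> b≰A′) (λ e → b≢ (sym e))

  below-root-inside : ∀ {A B} → graftLeft A B ≡ T → ∀ {y b} → RootIn A y → b ≤ size I →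
    WeaklyBelow I b y → b ≤ tsize A
  below-root-inside split (_ , _ , y≤) _ (inj₁ refl) = y≤
  below-root-inside {A} {B} split {y} {b} (_ , 1≤y , y≤) b≤ (inj₂ b◁y) with <-cmp b y
  ... | tri< b<y _ _ = ≤-trans (<⇒≤ b<y) y≤
  ... | tri≈ _ refl _ = y≤
  ... | tri> _ _ y<b with split-inv split (lowerTree-rightDesc LT 1≤y y<b b≤ b◁y)
  ...   | inj₁ dA = rightDesc-upper dA
  ...   | inj₂ (shifted {a′} y≡ _ dB) =
    ⊥-elim (<-irrefl refl (<-≤-trans (m<m+n (tsize A) (proj₁ (rightDesc-bounds dB))) (≤-trans (≤-reflexive (sym y≡)) y≤)))

no-vertex : ∀ {k x} → k ≡ 0 → 1 ≤ x → x ≤ k → ⊥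
no-vertex refl 1≤x x≤0 = 1+n≰n (≤-trans 1≤x x≤0)

module Grafting (I₁ I₂ : IntervalPoset) where

  n : ℕ
  n = size I₁

  data LeftGraftShape (x z : ℕ) : Set where
    inside₁ : _◁_ I₁ x z → LeftGraftShape x z
    inside₂ : ∀ {x′ z′} → x ≡ n + x′ → z ≡ n + z′ → _◁_ I₂ x′ z′ → LeftGraftShape x z
    upward  : 1 ≤ x → x ≤ n → n < z → LeftGraftShape x z

  leftGraftShape : ∀ {x z} → (I₁ ≺ I₂) x z → LeftGraftShape x z
  leftGraftShape [ g ]   = generator g
    where
    generator : ∀ {x z} → LeftGraftGen I₁ I₂ x z → LeftGraftShape x z
    generator (old (fst p)) = inside₁ p
    generator (old (snd p)) = inside₂ refl refl p
    generator (new 1≤x x≤n) = upward 1≤x x≤n ≤-refl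
  leftGraftShape (g ∷ c) = extend g (leftGraftShape c)
    where
    extend : ∀ {x y z} → LeftGraftGen I₁ I₂ x y → LeftGraftShape y z → LeftGraftShape x z
    extend (old (fst p)) (inside₁ q)       = inside₁ (◁-trans I₁ p q)
    extend (old (fst p)) (inside₂ y≡ _ q)  = ⊥-elim (<⇒≱ (beyond y≡ (◁-src-pos I₂ q)) (◁-tgt-bound I₁ p))
    extend (old (fst p)) (upward _ _ n<z)  = upward (◁-src-pos I₁ p) (◁-src-bound I₁ p) n<z
    extend (old (snd p)) (inside₁ q)       = ⊥-elim (<⇒≱ (beyond refl (◁-tgt-pos I₂ p)) (◁-src-bound I₁ q))
    extend (old (snd p)) (inside₂ y≡ z≡ q) = inside₂ refl z≡ (◁-trans I₂ p (subst (λ u → _◁_ I₂ u _) (sym (+-cancelˡ-≡ n _ _ y≡)) q))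
    extend (old (snd p)) (upward _ y≤n _)  = ⊥-elim (<⇒≱ (beyond refl (◁-tgt-pos I₂ p)) y≤n)
    extend (new _ _)     (inside₁ q)       = ⊥-elim (1+n≰n (◁-src-bound I₁ q))
    extend (new 1≤x x≤n) (inside₂ _ z≡ q)  = upward 1≤x x≤n (beyond z≡ (◁-tgt-pos I₂ q))
    extend (new _ _)     (upward _ n+1≤n _) = ⊥-elim (1+n≰n n+1≤n)

  data RightGraftShape (i x z : ℕ) : Set where
    inside₁  : _◁_ I₁ x z → RightGraftShape i x z
    inside₂  : ∀ {x′ z′} → x ≡ n + x′ → z ≡ n + z′ → _◁_ I₂ x′ z′ → RightGraftShape i x z
    downward : ∀ {x′ y} → x ≡ n + x′ → y ∈ take i (decRoots I₂) → WeaklyBelow I₂ x′ y → WeaklyBelow I₁ n z →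
               RightGraftShape i x z

  rightGraftShape : ∀ {i x z} → (I₁ ≻[ i ] I₂) x z → RightGraftShape i x z
  rightGraftShape {i} [ g ]   = generator g
    where
    generator : ∀ {x z} → RightGraftGen I₁ I₂ i x z → RightGraftShape i x z
    generator (old (fst p)) = inside₁ p
    generator (old (snd p)) = inside₂ refl refl p
    generator (new y∈)      = downward refl y∈ (inj₁ refl) (inj₁ refl)
  rightGraftShape {i} (g ∷ c) = extend g (rightGraftShape c)
    where
    -- a vertex weakly below a decreasing root is a shifted vertex of I₂, hence beyond n
    root-beyond : ∀ {y x′ r} → y ≡ n + x′ → r ∈ take i (decRoots I₂) → WeaklyBelow I₂ x′ r → n < y
    root-beyond y≡ r∈ x′⊴r = beyond y≡ (weaklyBelow-pos I₂ (proj₁ (decRoot-bounds I₂ i r∈)) x′⊴r)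
    extend : ∀ {x y z} → RightGraftGen I₁ I₂ i x y → RightGraftShape i y z → RightGraftShape i x z
    extend (old (fst p)) (inside₁ q)              = inside₁ (◁-trans I₁ p q)
    extend (old (fst p)) (inside₂ y≡ _ q)         = ⊥-elim (<⇒≱ (beyond y≡ (◁-src-pos I₂ q)) (◁-tgt-bound I₁ p))
    extend (old (fst p)) (downward y≡ r∈ x′⊴r _)  = ⊥-elim (<⇒≱ (root-beyond y≡ r∈ x′⊴r) (◁-tgt-bound I₁ p))
    extend (old (snd p)) (inside₁ q)              = ⊥-elim (<⇒≱ (beyond refl (◁-tgt-pos I₂ p)) (◁-src-bound I₁ q))
    extend (old (snd p)) (inside₂ y≡ z≡ q)        =
      inside₂ refl z≡ (◁-trans I₂ p (subst (λ u → _◁_ I₂ u _) (sym (+-cancelˡ-≡ n _ _ y≡)) q))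
    extend (old (snd p)) (downward y≡ r∈ y′⊴r q)  =
      downward refl r∈ (inj₂ (◁-⊴-trans I₂ p (subst (λ u → WeaklyBelow I₂ u _) (sym (+-cancelˡ-≡ n _ _ y≡)) y′⊴r))) q
    extend (new y∈)      (inside₁ q)              = downward refl y∈ (inj₁ refl) (inj₂ q)
    extend (new y∈)      (inside₂ n≡ _ q)         = ⊥-elim (<-irrefl refl (beyond n≡ (◁-src-pos I₂ q)))
    extend (new y∈)      (downward n≡ r∈ x′⊴r _)  = ⊥-elim (<-irrefl refl (root-beyond n≡ r∈ x′⊴r))

  leftGraft-emptyLeft : n ≡ 0 → ∀ x y → (I₁ ≺ I₂) x y ⇔ _◁_ I₂ x y
  leftGraft-emptyLeft n≡0 x y = mk⇔ graft⇒I₂ (λ p → subst₂ (I₁ ≺ I₂) (unshift refl) (unshift refl) [ old (snd p) ])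
    where
    unshift : ∀ {u u′} → u ≡ n + u′ → u ≡ u′
    unshift {u′ = u′} u≡ = trans u≡ (cong (_+ u′) n≡0)
    graft⇒I₂ : (I₁ ≺ I₂) x y → _◁_ I₂ x y
    graft⇒I₂ c with leftGraftShape c
    ... | inside₁ p         = ⊥-elim (no-vertex n≡0 (◁-src-pos I₁ p) (◁-src-bound I₁ p))
    ... | inside₂ x≡ y≡ p   = subst₂ (_◁_ I₂) (sym (unshift x≡)) (sym (unshift y≡)) p
    ... | upward 1≤x x≤n _  = ⊥-elim (no-vertex n≡0 1≤x x≤n)

  rightGraft-emptyRight : size I₂ ≡ 0 → ∀ {i} x y → (I₁ ≻[ i ] I₂) x y ⇔ _◁_ I₁ x y
  rightGraft-emptyRight m≡0 {i} x y = mk⇔ graft⇒I₁ (λ p → [ old (fst p) ])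
    where
    graft⇒I₁ : (I₁ ≻[ i ] I₂) x y → _◁_ I₁ x y
    graft⇒I₁ c with rightGraftShape c
    ... | inside₁ p             = p
    ... | inside₂ _ _ p         = ⊥-elim (no-vertex m≡0 (◁-src-pos I₂ p) (◁-src-bound I₂ p))
    ... | downward _ r∈ _ _     = ⊥-elim (no-vertex m≡0 (proj₁ (decRoot-bounds I₂ i r∈)) (proj₂ (decRoot-bounds I₂ i r∈)))

module _ (I : IntervalPoset) {T : Tree} (LT : IsLowerTree (size I) (_◁_ I) T) where

  above-last⇒onRightBranch : 0 < size I → ∀ {a} → WeaklyBelow I (size I) a → OnRightBranch T a
  above-last⇒onRightBranch N>0 (inj₁ refl) =
    subst (OnRightBranch T) (proj₁ LT) (onRightBranch-last T (subst (0 <_) (sym (proj₁ LT)) N>0))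
  above-last⇒onRightBranch N>0 {a} (inj₂ N◁a) with a ≟ size I
  ... | yes refl = above-last⇒onRightBranch N>0 (inj₁ refl)
  ... | no  a≢N  = rightDesc-last⇒onRightBranch
    (lowerTree-rightDesc LT (◁-tgt-pos I N◁a) (≤∧≢⇒< (◁-tgt-bound I N◁a) a≢N) ≤-refl N◁a) (sym (proj₁ LT))

  onRightBranch⇒above-last : ∀ {a} → OnRightBranch T a → WeaklyBelow I (size I) a
  onRightBranch⇒above-last ob with onRightBranch⇒rightDesc-last ob
  ... | inj₁ a≡ = inj₁ (sym (trans a≡ (proj₁ LT)))
  ... | inj₂ d  = inj₂ (lowerTree-rel LT (subst (RightDesc T _) (proj₁ LT) d))

module GraftLowerTrees (I₁ I₂ : IntervalPoset) (T₁ T₂ : Tree)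
  (L₁ : IsLowerTree (size I₁) (_◁_ I₁) T₁) (L₂ : IsLowerTree (size I₂) (_◁_ I₂) T₂) where

  open Grafting I₁ I₂

  m : ℕ
  m = size I₂

  shift₁ : ∀ {x x′} → x ≡ n + x′ → tsize T₁ + x′ ≡ x
  shift₁ {x′ = x′} x≡ = trans (cong (_+ x′) (proj₁ L₁)) (sym x≡)

  unshift₁ : ∀ {x x′} → x ≡ tsize T₁ + x′ → n + x′ ≡ x
  unshift₁ {x′ = x′} x≡ = trans (cong (_+ x′) (sym (proj₁ L₁))) (sym x≡)

  shifted-rightDesc : ∀ {a b a′ b′} → a < b → b ≡ n + b′ → a ≡ n + a′ → _◁_ I₂ b′ a′ → RightDesc T₂ a′ b′
  shifted-rightDesc a<b b≡ a≡ p = lowerTree-rightDesc L₂ (◁-tgt-pos I₂ p)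
    (+-cancelˡ-< n _ _ (subst₂ _<_ a≡ b≡ a<b)) (◁-src-bound I₂ p) p

  leftGraft-lowerTree : IsLowerTree (n + m) (I₁ ≺ I₂) (graftLeft T₁ T₂)
  leftGraft-lowerTree = trans (tsize-graftLeft T₁ T₂) (cong₂ _+_ (proj₁ L₁) (proj₁ L₂)) ,
    λ a b 1≤a a<b _ → mk⇔ (graft⇒rightDesc 1≤a a<b) graft⇐rightDesc
    where
    -- decreasing relations of the graft stay inside I₁ or inside I₂
    graft⇒rightDesc : ∀ {a b} → 1 ≤ a → a < b → (I₁ ≺ I₂) b a → RightDesc (graftLeft T₁ T₂) a b
    graft⇒rightDesc 1≤a a<b c with leftGraftShape c
    ... | inside₁ p         = rightDesc-graftLeft-inner T₁ T₂ (lowerTree-rightDesc L₁ 1≤a a<b (◁-src-bound I₁ p) p)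
    ... | inside₂ b≡ a≡ p   = rightDesc-cast (shift₁ a≡) (shift₁ b≡)
                                (rightDesc-graftLeft-outer T₁ (shifted-rightDesc a<b b≡ a≡ p))
    ... | upward _ b≤n n<a  = ⊥-elim (<-asym a<b (≤-<-trans b≤n n<a))
    graft⇐rightDesc : ∀ {a b} → RightDesc (graftLeft T₁ T₂) a b → (I₁ ≺ I₂) b a
    graft⇐rightDesc d with rightDesc-graftLeft-inv T₁ T₂ d
    ... | inj₁ d₁                   = [ old (fst (lowerTree-rel L₁ d₁)) ]
    ... | inj₂ (shifted a≡ b≡ d₂)   = subst₂ (I₁ ≺ I₂) (unshift₁ b≡) (unshift₁ a≡) [ old (snd (lowerTree-rel L₂ d₂)) ]

  module RightGraft (n>0 : 0 < n) (A B : Tree) (split : graftLeft A B ≡ T₂) {i : ℕ} (spine : leftSpine A ≡ i) where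

    open DecreasingRoots I₂ T₂ L₂

    Ts : Tree
    Ts = graftLeft (hangRight T₁ A) B

    hang-size : tsize (hangRight T₁ A) ≡ n + tsize A
    hang-size = trans (tsize-hangRight T₁ A) (cong (_+ tsize A) (proj₁ L₁))

    first-roots : ∀ {y} → y ∈ take i (decRoots I₂) ⇔ RootIn A y
    first-roots {y} = subst (λ k → y ∈ take k (decRoots I₂) ⇔ RootIn A y) spine (firstRoots-mem split)

    from-root : ∀ {r a} → r ∈ take i (decRoots I₂) → WeaklyBelow I₁ n a → (I₁ ≻[ i ] I₂) (n + r) a
    from-root r∈ (inj₁ refl) = [ new r∈ ]
    from-root r∈ (inj₂ n◁a)  = new r∈ ∷ [ old (fst n◁a) ]

    descend : ∀ {x′ r a} → r ∈ take i (decRoots I₂) → WeaklyBelow I₂ x′ r → WeaklyBelow I₁ n a → (I₁ ≻[ i ] I₂) (n + x′) a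
    descend r∈ (inj₁ refl) n⊴a = from-root r∈ n⊴a
    descend r∈ (inj₂ x′◁r) n⊴a = old (snd x′◁r) ∷ from-root r∈ n⊴a

    -- A decreasing relation of the graft is inside I₁, inside I₂ (then in A or in B), or goes
    -- from weakly below a root of A to the right branch of T₁, across the hanging point.
    rightGraft⇒rightDesc : ∀ {a b} → 1 ≤ a → a < b → b ≤ n + m → (I₁ ≻[ i ] I₂) b a → RightDesc Ts a b
    rightGraft⇒rightDesc 1≤a a<b b≤ c with rightGraftShape c
    ... | inside₁ p = rightDesc-graftLeft-inner _ B (rightDesc-hangRight-inner A (lowerTree-rightDesc L₁ 1≤a a<b (◁-src-bound I₁ p) p))
    ... | inside₂ {b′} {a′} b≡ a≡ p with split-inv split (shifted-rightDesc a<b b≡ a≡ p)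
    ...   | inj₁ dA = rightDesc-graftLeft-inner _ B
                        (rightDesc-cast (shift₁ a≡) (shift₁ b≡) (rightDesc-hangRight-outer T₁ A dA))
    ...   | inj₂ (shifted a′≡ b′≡ dB) = rightDesc-cast (unshift a≡ a′≡) (unshift b≡ b′≡) (rightDesc-graftLeft-outer (hangRight T₁ A) dB)
      where
      unshift : ∀ {x x′ x″} → x ≡ n + x′ → x′ ≡ tsize A + x″ → tsize (hangRight T₁ A) + x″ ≡ x
      unshift {x″ = x″} x≡ x′≡ =
        trans (cong (_+ x″) hang-size) (trans (+-assoc n (tsize A) x″) (sym (trans x≡ (cong (n +_) x′≡))))
    rightGraft⇒rightDesc 1≤a a<b b≤ c | downward {b′} b≡ r∈ b′⊴r n⊴a =
      rightDesc-graftLeft-inner _ B (rightDesc-cast refl (shift₁ b≡)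
        (rightDesc-hangRight-cross A (above-last⇒onRightBranch I₁ L₁ n>0 n⊴a)
          (weaklyBelow-pos I₂ (proj₁ (proj₂ r-root)) b′⊴r)
          (below-root-inside split r-root (+-cancelˡ-≤ n _ _ (subst (_≤ n + m) b≡ b≤)) b′⊴r)))
      where
      r-root : RootIn A _
      r-root = to first-roots r∈

    rightDesc⇒rightGraft : ∀ {a b} → RightDesc Ts a b → (I₁ ≻[ i ] I₂) b a
    rightDesc⇒rightGraft d with rightDesc-graftLeft-inv (hangRight T₁ A) B d
    ... | inj₂ (shifted a≡ b≡ dB) = subst₂ (I₁ ≻[ i ] I₂) (unshift b≡) (unshift a≡)
            [ old (snd (lowerTree-rel L₂ (subst (λ U → RightDesc U _ _) split (rightDesc-graftLeft-outer A dB)))) ]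
      where
      unshift : ∀ {x x″} → x ≡ tsize (hangRight T₁ A) + x″ → n + (tsize A + x″) ≡ x
      unshift {x″ = x″} x≡ = sym (trans x≡ (trans (cong (_+ x″) hang-size) (+-assoc n (tsize A) x″)))
    ... | inj₁ dh with rightDesc-hangRight-inv T₁ A dh
    ...   | inj₁ d₁ = [ old (fst (lowerTree-rel L₁ d₁)) ]
    ...   | inj₂ (inj₁ (shifted a≡ b≡ dA)) =
            subst₂ (I₁ ≻[ i ] I₂) (unshift₁ b≡) (unshift₁ a≡) [ old (snd (lowerTree-rel L₂ (split-inner split dA))) ]
    ...   | inj₂ (inj₂ (ob , block b≡ 1≤b′ b′≤A)) with below-root A B split 1≤b′ b′≤A
    ...     | r , r-root , b′⊴r = subst (λ x → (I₁ ≻[ i ] I₂) x _) (unshift₁ b≡)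
                                  (descend (from first-roots r-root) b′⊴r (onRightBranch⇒above-last I₁ L₁ ob))

    rightGraft-lowerTree : IsLowerTree (n + m) (I₁ ≻[ i ] I₂) Ts
    rightGraft-lowerTree = size-eq , λ a b 1≤a a<b b≤ → mk⇔ (rightGraft⇒rightDesc 1≤a a<b b≤) rightDesc⇒rightGraft
      where
      size-eq : tsize Ts ≡ n + m
      size-eq = begin
        tsize (graftLeft (hangRight T₁ A) B)   ≡⟨ tsize-graftLeft (hangRight T₁ A) B ⟩
        tsize (hangRight T₁ A) + tsize B       ≡⟨ cong (_+ tsize B) hang-size ⟩
        n + tsize A + tsize B                  ≡⟨ +-assoc n (tsize A) (tsize B) ⟩
        n + (tsize A + tsize B)                ≡⟨ cong (n +_) (tsize-graftLeft A B) ⟨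
        n + tsize (graftLeft A B)              ≡⟨ cong (λ U → n + tsize U) split ⟩
        n + tsize T₂                           ≡⟨ cong (n +_) (proj₁ L₂) ⟩
        n + m                                  ∎
        where open ≡-Reasoning

hangRight-leaf : ∀ T → hangRight T leaf ≡ T
hangRight-leaf leaf       = refl
hangRight-leaf (node l r) = cong (node l) (hangRight-leaf r)

graftLeft-leaf : ∀ B → graftLeft leaf B ≡ B
graftLeft-leaf leaf       = refl
graftLeft-leaf (node l r) = cong (λ X → node X r) (graftLeft-leaf l)

splitLeftSpine : ∀ T i → i ≤ leftSpine T → Σ Tree λ A → Σ Tree λ B → (graftLeft A B ≡ T) × (leftSpine A ≡ i)
splitLeftSpine leaf       .0 z≤n = leaf , leaf , refl , refl
splitLeftSpine (node l r) i  i≤ with i ≟ suc (leftSpine l)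
... | yes i≡ = node l r , leaf , refl , sym i≡
... | no  i≢ with splitLeftSpine l i (≤-pred (≤∧≢⇒< i≤ i≢))
...   | A , B , split , spine = A , node B r , cong (λ X → node X r) split , spine

module _ (I₁ I₂ : IntervalPoset) (T₁ T₂ : Tree)
  (L₁ : IsLowerTree (size I₁) (_◁_ I₁) T₁) (L₂ : IsLowerTree (size I₂) (_◁_ I₂) T₂) where

  open Grafting I₁ I₂ using (n; leftGraft-emptyLeft; rightGraft-emptyRight)
  open GraftLowerTrees I₁ I₂ T₁ T₂ L₁ L₂ using (m; leftGraft-lowerTree; module RightGraft)

  nonEmpty : ∀ {U k} → tsize U ≡ k → 0 < k → 0 < tsize U
  nonEmpty refl k>0 = k>0

  -- Left grafting: the lower tree is graftLeft (hangRight T₁ leaf) (graftLeft leaf T₂).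
  leftGraft-contacts : 0 < n → 0 < m → (T : Tree) → IsLowerTree (n + m) (I₁ ≺ I₂) T → ContactFormula T T₁ T₂ 0 n m
  leftGraft-contacts n>0 m>0 T LT = subst₂ (ContactFormula T T₁ T₂ 0) (proj₁ L₁) (proj₁ L₂)
    (contactFormula-graft leaf T₂ T≡ (graftLeft-leaf T₂) (nonEmpty (proj₁ L₁) n>0) (nonEmpty (proj₁ L₂) m>0))
    where
    T≡ : T ≡ graftLeft (hangRight T₁ leaf) T₂
    T≡ = trans (lowerTree-unique LT leftGraft-lowerTree) (cong (λ U → graftLeft U T₂) (sym (hangRight-leaf T₁)))

  -- Right grafting: decompose T₂ with leftSpine A = i; the lower tree is the tree of (ii).
  rightGraft-contacts : 0 < n → 0 < m → (i : ℕ) → i ≤ contacts (dyck T₂) → (T : Tree) →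
    IsLowerTree (n + m) (I₁ ≻[ i ] I₂) T → ContactFormula T T₁ T₂ i n m
  rightGraft-contacts n>0 m>0 i i≤ T LT with splitLeftSpine T₂ i (subst (i ≤_) (contacts-dyck T₂) i≤)
  ... | A , B , split , spine = subst₂ (ContactFormula T T₁ T₂ i) (proj₁ L₁) (proj₁ L₂)
    (subst (λ k → ContactFormula T T₁ T₂ k (tsize T₁) (tsize T₂)) spine
      (contactFormula-graft A B (lowerTree-unique LT (RightGraft.rightGraft-lowerTree n>0 A B split spine)) split
        (nonEmpty (proj₁ L₁) n>0) (nonEmpty (proj₁ L₂) m>0)))

  -- Empty I₁ (resp. I₂): the graft has the same lower tree as I₂ (resp. I₁).
  leftGraft-empty : n ≡ 0 → (T : Tree) → IsLowerTree (n + m) (I₁ ≺ I₂) T → CV (dyck T) (n + m) ≡ CV (dyck T₂) m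
  leftGraft-empty n≡0 T LT = cong₂ (λ U k → CV (dyck U) k)
    (lowerTree-unique (lowerTree-cong (cong (_+ m) n≡0) (leftGraft-emptyLeft n≡0) LT) L₂) (cong (_+ m) n≡0)

  rightGraft-empty : m ≡ 0 → (i : ℕ) → (T : Tree) → IsLowerTree (n + m) (I₁ ≻[ i ] I₂) T → CV (dyck T) (n + m) ≡ CV (dyck T₁) n
  rightGraft-empty m≡0 i T LT = cong₂ (λ U k → CV (dyck U) k)
    (lowerTree-unique (lowerTree-cong n+m≡n (rightGraft-emptyRight m≡0) LT) L₁) n+m≡n
    where
    n+m≡n : n + m ≡ n
    n+m≡n = trans (cong (n +_) m≡0) (+-identityʳ n)

proposition4p2 : (I₁ I₂ : IntervalPoset) (T₁ T₂ : Tree) →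
    IsLowerTree (size I₁) (_◁_ I₁) T₁ → IsLowerTree (size I₂) (_◁_ I₂) T₂ →
    ((0 < size I₁ → 0 < size I₂ → (T : Tree) →
        IsLowerTree (size I₁ + size I₂) (I₁ ≺ I₂) T →
        (contacts (dyck T) ≡ contacts (dyck T₁) + contacts (dyck T₂))
        × (CV (dyck T) (size I₁ + size I₂)
           ≡ (contacts (dyck T₁) + contacts (dyck T₂))
             ∷ (cs (dyck T₁) (size I₁) ++ (0 ∷ cs (dyck T₂) (size I₂)))))
    × (0 < size I₁ → 0 < size I₂ → (i : ℕ) → i ≤ contacts (dyck T₂) → (T : Tree) →
        IsLowerTree (size I₁ + size I₂) (I₁ ≻[ i ] I₂) T →
        (contacts (dyck T) ≡ contacts (dyck T₁) + contacts (dyck T₂) ∸ i)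
        × (CV (dyck T) (size I₁ + size I₂)
           ≡ (contacts (dyck T₁) + contacts (dyck T₂) ∸ i)
             ∷ (cs (dyck T₁) (size I₁) ++ (i ∷ cs (dyck T₂) (size I₂)))))
    × (size I₁ ≡ 0 →
        (∀ x y → (I₁ ≺ I₂) x y ⇔ (_◁_ I₂) x y)
        × ((T : Tree) → IsLowerTree (size I₁ + size I₂) (I₁ ≺ I₂) T →
            CV (dyck T) (size I₁ + size I₂) ≡ CV (dyck T₂) (size I₂)))
    × (size I₂ ≡ 0 → (i : ℕ) → i ≤ contacts (dyck T₂) →
        (∀ x y → (I₁ ≻[ i ] I₂) x y ⇔ (_◁_ I₁) x y)
        × ((T : Tree) → IsLowerTree (size I₁ + size I₂) (I₁ ≻[ i ] I₂) T →
            CV (dyck T) (size I₁ + size I₂) ≡ CV (dyck T₁) (size I₁))))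
proposition4p2 I₁ I₂ T₁ T₂ L₁ L₂ =
    leftGraft-contacts I₁ I₂ T₁ T₂ L₁ L₂
  , rightGraft-contacts I₁ I₂ T₁ T₂ L₁ L₂
  , (λ n≡0 → Grafting.leftGraft-emptyLeft I₁ I₂ n≡0 , leftGraft-empty I₁ I₂ T₁ T₂ L₁ L₂ n≡0)
  , (λ m≡0 i _ → Grafting.rightGraft-emptyRight I₁ I₂ m≡0 , rightGraft-empty I₁ I₂ T₁ T₂ L₁ L₂ m≡0 i)
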